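{- Let $n$ and $i$ be positive integers. The number of partitions $\lambda\vdash n$ which contain the part $i$ with multiplicity exactly $i$ equals the number of partitions $\mu=(\mu_1,\dots,\mu_t)\vdash n$ for which there is an index $s$ with $1\le s\le t$, $h_{s,1}(\mu)=s$ and $\mu_s=i$.
   Context: A partition $\mu=(\mu_1,\dots,\mu_t)$ of $n$ is a nonincreasing sequence of positive integers with sum $n$; $t$ is its number of parts. The first-column hook lengths are $h_{s,1}(\mu)=\mu_s+t-s$ for $1\le s\le t$ (the hook length of box $(s,1)$ in the Young diagram). -}

module Defs where

open import Data.Nat using (ℕ; zero; suc; _+_; _∸_; _≥_; _<_; _≟_)
open import Data.Nat.ListAction using (sum)
open import Data.List using (List; length; lookup; filter)
open import Data.List.Relation.Unary.All using (All)
open import Data.List.Relation.Unary.Linked using (Linked)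
open import Data.Fin using (Fin; toℕ)
open import Data.Fin.Properties using (any?)
open import Data.Product using (Σ; _×_; _,_; proj₁)
open import Relation.Binary.PropositionalEquality using (_≡_)
open import Relation.Nullary.Decidable using (True; _×-dec_)

IsPartition : ℕ → List ℕ → Set
IsPartition n μ = Linked _≥_ μ × All (0 <_) μ × sum μ ≡ n

Partition : ℕ → Set
Partition n = Σ (List ℕ) (IsPartition n)

numParts : List ℕ → ℕ
numParts = length

-- first-column hook length h_{s,1}(μ) = μ_s + t - s, with 1-based s = toℕ k + 1
hook1 : (μ : List ℕ) → Fin (length μ) → ℕ
hook1 μ k = lookup μ k + numParts μ ∸ suc (toℕ k)

multiplicity : ℕ → List ℕ → ℕ
multiplicity i μ = length (filter (_≟ i) μ)

-- ∃ s with 1 ≤ s ≤ t, h_{s,1}(μ) = s and μ_s = i  (decidable, hence proof-irrelevant via True)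
HasHookIndex? : (i : ℕ) (μ : List ℕ) → _
HasHookIndex? i μ =
  any? λ (k : Fin (length μ)) → (hook1 μ k ≟ suc (toℕ k)) ×-dec (lookup μ k ≟ i)

module Submission where

-- Write i = b + 1.  A partition λ in which the part i has multiplicity exactly i is
--   λ = (x + (i + 1)) ++ iⁱ ++ β   (adding i + 1 to every entry of x)
-- with x any nonincreasing list of naturals, of length m say, and β a partition with parts at most b,
-- so |λ| = |x| + |β| + m(i + 1) + i².  A partition μ with t parts and an index s such that μ_s = i is
--   μ = (z + i) ++ i ∷ (e + 1)
-- with z and e nonincreasing, e bounded by b, z of length s - 1 and e of length t - s.  The hook
-- condition s = h_{s,1}(μ) = i + (t - s) says exactly that z has m + b entries when e has m, and
-- then |μ| = |z| + |e| + m(i + 1) + i² as well.  It also reads 2s = t + i, so s is determined by μ.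
-- It remains to pair off (x, β) with (z, e) keeping m and |x| + |β| = |z| + |e|.  Read β through its
-- b columns (heights β'₁ ≥ … ≥ β'_b ≥ 0) and merge them with the entries of x into one
-- nonincreasing list z: an entry a of x that is placed while c columns are still pending enters z
-- as a - c and leaves the label c in e, a column enters z as its height.  The labels record how x
-- and the columns were interleaved, so the merge can be undone.

open import Defs
open import Data.Bool.Properties using (T-irrelevant)
open import Data.Fin using (Fin; zero; suc; toℕ)
open import Data.Fin.Properties using (toℕ<n)
open import Data.List using (List; []; _∷_; length; map; filter; replicate; take; drop; _++_; lookup)
open import Data.List.Membership.Propositional.Properties using (∈-lookup)
open import Data.List.Properties
  using ( ++-identityʳ; length-++; length-map; length-replicate; length-take; length-drop
        ; map-∘; map-id; map-id-local; filter-++; filter-all; filter-none; filter-accept; filter-reject )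
open import Data.List.Relation.Unary.All as All using (All; []; _∷_)
import Data.List.Relation.Unary.All.Properties as Allₚ
open import Data.List.Relation.Unary.AllPairs as AllPairs using (AllPairs; []; _∷_)
import Data.List.Relation.Unary.AllPairs.Properties as AllPairsₚ
open import Data.List.Relation.Unary.Linked as Linked using (Linked)
import Data.List.Relation.Unary.Linked.Properties as Linkedₚ
open import Data.Nat
  using (ℕ; zero; suc; pred; _+_; _*_; _∸_; _⊓_; _≟_; _≤_; _<_; _≥_; _≤?_; _<?_; z≤n; s≤s)
open import Data.Nat.ListAction using (sum)
open import Data.Nat.ListAction.Properties using (sum-++)
open import Data.Nat.Properties
open import Algebra.Properties.CommutativeSemigroup +-commutativeSemigroup using (x∙yz≈y∙xz; interchange)
open import Data.Nat.Tactic.RingSolver using (solve-∀)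
open import Data.Product using (Σ; _×_; _,_; proj₁; proj₂; map₁; map₂; uncurry)
import Data.Product as Product
open import Data.Product.Properties using (Σ-≡,≡→≡)
open import Function using (_∘_; id)
open import Function.Bundles using (_↔_; mk↔ₛ′)
open import Relation.Binary.Core using (_Preserves_⟶_)
open import Relation.Binary.Definitions using (tri<; tri≈; tri>)
open import Relation.Binary.PropositionalEquality
open import Relation.Nullary using (yes; no; ¬_; contradiction; Irrelevant)
open import Relation.Nullary.Decidable using (True; fromWitness; toWitness)

all-≡⇒replicate : ∀ {A : Set} {a : A} {xs} → All (_≡ a) xs → xs ≡ replicate (length xs) a
all-≡⇒replicate         []           = refl
all-≡⇒replicate {a = a} (refl ∷ xs≡) = cong (a ∷_) (all-≡⇒replicate xs≡)

take-length-++ : ∀ {A : Set} (xs ys : List A) → take (length xs) (xs ++ ys) ≡ xs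
take-length-++ []       ys = refl
take-length-++ (x ∷ xs) ys = cong (x ∷_) (take-length-++ xs ys)

drop-length-++-∷ : ∀ {A : Set} (xs : List A) y ys → drop (suc (length xs)) (xs ++ y ∷ ys) ≡ ys
drop-length-++-∷ []       y ys = refl
drop-length-++-∷ (x ∷ xs) y ys = drop-length-++-∷ xs y ys

map-+-≥ : ∀ c x → All (c ≤_) (map (_+ c) x)
map-+-≥ c x = Allₚ.map⁺ (All.universal (m≤n+m c) x)

map-+-∸ : ∀ c {x} → All (c ≤_) x → map (_+ c) (map (_∸ c) x) ≡ x
map-+-∸ c {x} x≥c = trans (sym (map-∘ x)) (map-id-local (All.map m∸n+n≡m x≥c))

map-∸-+ : ∀ c x → map (_∸ c) (map (_+ c) x) ≡ x
map-∸-+ c x = trans (sym (map-∘ x)) (map-id-local (All.universal (λ a → m+n∸n≡m a c) x))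

sum-replicate : ∀ k a → sum (replicate k a) ≡ k * a
sum-replicate zero    a = refl
sum-replicate (suc k) a = cong (a +_) (sum-replicate k a)

sum-map-+ : ∀ c x → sum (map (_+ c) x) ≡ sum x + length x * c
sum-map-+ c []      = refl
sum-map-+ c (a ∷ x) = trans (cong (a + c +_) (sum-map-+ c x)) (interchange a c (sum x) (length x * c))

sum-map-suc : ∀ x → sum (map suc x) ≡ sum x + length x
sum-map-suc []      = refl
sum-map-suc (a ∷ x) = begin
  suc (a + sum (map suc x))    ≡⟨ cong (λ s → suc (a + s)) (sum-map-suc x) ⟩
  suc (a + (sum x + length x)) ≡⟨ cong suc (+-assoc a (sum x) (length x)) ⟨
  suc (a + sum x + length x)   ≡⟨ +-suc (a + sum x) (length x) ⟨
  a + sum x + suc (length x)   ∎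
  where open ≡-Reasoning

≡-by-proj₁ : ∀ {A : Set} {P : A → Set} → (∀ {a} → Irrelevant (P a)) →
  {p q : Σ A P} → proj₁ p ≡ proj₁ q → p ≡ q
≡-by-proj₁ P-irr eq = Σ-≡,≡→≡ (eq , P-irr _ _)

Nonincreasing : List ℕ → Set
Nonincreasing = AllPairs _≥_

NonincreasingAtMost : ℕ → List ℕ → Set
NonincreasingAtMost b l = Nonincreasing l × All (_≤ b) l

PartsAtMost : ℕ → List ℕ → Set
PartsAtMost b β = NonincreasingAtMost b β × All (0 <_) β

Linked⇒Nonincreasing : ∀ {l} → Linked _≥_ l → Nonincreasing l
Linked⇒Nonincreasing = Linkedₚ.Linked⇒AllPairs (λ b≤a c≤b → ≤-trans c≤b b≤a)

Nonincreasing⇒Linked : ∀ {l} → Nonincreasing l → Linked _≥_ l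
Nonincreasing⇒Linked = Linkedₚ.AllPairs⇒Linked

replicate-nonincreasing : ∀ k a → Nonincreasing (replicate k a)
replicate-nonincreasing zero    a = []
replicate-nonincreasing (suc k) a = Allₚ.replicate⁺ k ≤-refl ∷ replicate-nonincreasing k a

map-nonincreasing : ∀ {f} → f Preserves _≤_ ⟶ _≤_ → ∀ {l} → Nonincreasing l → Nonincreasing (map f l)
map-nonincreasing f-mono l↓ = AllPairsₚ.map⁺ (AllPairs.map f-mono l↓)

++-nonincreasing : ∀ c {xs ys} → Nonincreasing xs → Nonincreasing ys →
  All (c ≤_) xs → All (_≤ c) ys → Nonincreasing (xs ++ ys)
++-nonincreasing c xs↓ ys↓ xs≥c ys≤c =
  AllPairsₚ.++⁺ xs↓ ys↓ (All.map (λ c≤x → All.map (λ y≤c → ≤-trans y≤c c≤x) ys≤c) xs≥c)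

partsAtMost-0 : ∀ {β} → PartsAtMost 0 β → β ≡ []
partsAtMost-0 {[]}    _                       = refl
partsAtMost-0 {_ ∷ _} ((_ , z≤n ∷ _) , () ∷ _)

nonincreasingAtMost-pred : ∀ {b e₁ e} → e₁ ≢ suc b →
  NonincreasingAtMost (suc b) (e₁ ∷ e) → NonincreasingAtMost b (e₁ ∷ e)
nonincreasingAtMost-pred e₁≢b+1 (e₁≥e ∷ e↓ , e₁≤b+1 ∷ _) =
  e₁≥e ∷ e↓ , e₁≤b ∷ All.map (λ c≤e₁ → ≤-trans c≤e₁ e₁≤b) e₁≥e
  where e₁≤b = ≤-pred (≤∧≢⇒< e₁≤b+1 e₁≢b+1)

-- Columns of a Young diagram

dropColumn : List ℕ → List ℕ
dropColumn []                = []
dropColumn (zero ∷ β)        = dropColumn β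
dropColumn (suc zero ∷ β)    = dropColumn β
dropColumn (suc (suc a) ∷ β) = suc a ∷ dropColumn β

addColumn : ℕ → List ℕ → List ℕ
addColumn h β = map suc β ++ replicate (h ∸ length β) 1

length-dropColumn : ∀ β → length (dropColumn β) ≤ length β
length-dropColumn []                = z≤n
length-dropColumn (zero ∷ β)        = m≤n⇒m≤1+n (length-dropColumn β)
length-dropColumn (suc zero ∷ β)    = m≤n⇒m≤1+n (length-dropColumn β)
length-dropColumn (suc (suc a) ∷ β) = s≤s (length-dropColumn β)

sum-dropColumn : ∀ {β} → All (0 <_) β → sum β ≡ length β + sum (dropColumn β)
sum-dropColumn {[]}              []        = refl
sum-dropColumn {suc zero ∷ β}    (_ ∷ β>0) = cong suc (sum-dropColumn β>0)
sum-dropColumn {suc (suc a) ∷ β} (_ ∷ β>0) = cong suc (begin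
  suc a + sum β                           ≡⟨ cong (suc a +_) (sum-dropColumn β>0) ⟩
  suc a + (length β + sum (dropColumn β)) ≡⟨ x∙yz≈y∙xz (suc a) (length β) _ ⟩
  length β + (suc a + sum (dropColumn β)) ∎)
  where open ≡-Reasoning

dropColumn-positive : ∀ β → All (0 <_) (dropColumn β)
dropColumn-positive []                = []
dropColumn-positive (zero ∷ β)        = dropColumn-positive β
dropColumn-positive (suc zero ∷ β)    = dropColumn-positive β
dropColumn-positive (suc (suc a) ∷ β) = s≤s z≤n ∷ dropColumn-positive β

dropColumn-≤ : ∀ {b β} → All (_≤ suc b) β → All (_≤ b) (dropColumn β)
dropColumn-≤ {β = []}              []             = []
dropColumn-≤ {β = zero ∷ β}        (_ ∷ β≤)       = dropColumn-≤ β≤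
dropColumn-≤ {β = suc zero ∷ β}    (_ ∷ β≤)       = dropColumn-≤ β≤
dropColumn-≤ {β = suc (suc a) ∷ β} (s≤s a≤b ∷ β≤) = a≤b ∷ dropColumn-≤ β≤

dropColumn-nonincreasing : ∀ {β} → Nonincreasing β → Nonincreasing (dropColumn β)
dropColumn-nonincreasing {[]}              []        = []
dropColumn-nonincreasing {zero ∷ β}        (_ ∷ β↓)  = dropColumn-nonincreasing β↓
dropColumn-nonincreasing {suc zero ∷ β}    (_ ∷ β↓)  = dropColumn-nonincreasing β↓
dropColumn-nonincreasing {suc (suc a) ∷ β} (β≤ ∷ β↓) = dropColumn-≤ β≤ ∷ dropColumn-nonincreasing β↓

dropColumn-partsAtMost : ∀ {b β} → PartsAtMost (suc b) β → PartsAtMost b (dropColumn β)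
dropColumn-partsAtMost {β = β} ((β↓ , β≤) , _) =
  (dropColumn-nonincreasing β↓ , dropColumn-≤ β≤) , dropColumn-positive β

dropColumn-++ : ∀ xs ys → dropColumn (xs ++ ys) ≡ dropColumn xs ++ dropColumn ys
dropColumn-++ []                 ys = refl
dropColumn-++ (zero ∷ xs)        ys = dropColumn-++ xs ys
dropColumn-++ (suc zero ∷ xs)    ys = dropColumn-++ xs ys
dropColumn-++ (suc (suc a) ∷ xs) ys = cong (suc a ∷_) (dropColumn-++ xs ys)

dropColumn-≤1 : ∀ {β} → All (_≤ 1) β → dropColumn β ≡ []
dropColumn-≤1 []                                = refl
dropColumn-≤1 {zero ∷ β}        (_ ∷ β≤1)       = dropColumn-≤1 β≤1
dropColumn-≤1 {suc zero ∷ β}    (_ ∷ β≤1)       = dropColumn-≤1 β≤1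
dropColumn-≤1 {suc (suc _) ∷ β} (s≤s () ∷ _)

length-addColumn : ∀ {h} β → length β ≤ h → length (addColumn h β) ≡ h
length-addColumn {h} β β≤h = begin
  length (map suc β ++ replicate (h ∸ length β) 1)         ≡⟨ length-++ (map suc β) ⟩
  length (map suc β) + length (replicate (h ∸ length β) 1) ≡⟨ cong₂ _+_ (length-map suc β)
                                                                       (length-replicate (h ∸ length β)) ⟩
  length β + (h ∸ length β)                                ≡⟨ m+[n∸m]≡n β≤h ⟩
  h                                                        ∎
  where open ≡-Reasoning

addColumn-partsAtMost : ∀ {b β} h → PartsAtMost b β → PartsAtMost (suc b) (addColumn h β)
addColumn-partsAtMost {β = β} h ((β↓ , β≤b) , _) =
  ( ++-nonincreasing 1 (map-nonincreasing s≤s β↓) (replicate-nonincreasing k 1)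
                       sucβ>0 (Allₚ.replicate⁺ k ≤-refl)
  , Allₚ.++⁺ (Allₚ.map⁺ (All.map s≤s β≤b)) (Allₚ.replicate⁺ k (s≤s z≤n)) )
  , Allₚ.++⁺ sucβ>0 (Allₚ.replicate⁺ k ≤-refl)
  where
  k = h ∸ length β
  sucβ>0 = Allₚ.map⁺ (All.universal (λ _ → s≤s z≤n) β)

dropColumn-addColumn : ∀ h {β} → All (0 <_) β → dropColumn (addColumn h β) ≡ β
dropColumn-addColumn h {β} β>0 = begin
  dropColumn (map suc β ++ ones)            ≡⟨ dropColumn-++ (map suc β) ones ⟩
  dropColumn (map suc β) ++ dropColumn ones ≡⟨ cong₂ _++_ (dropColumn-map-suc β>0) (dropColumn-≤1 ones≤1) ⟩
  β ++ []                                   ≡⟨ ++-identityʳ β ⟩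
  β                                         ∎
  where
  open ≡-Reasoning
  ones = replicate (h ∸ length β) 1
  ones≤1 = Allₚ.replicate⁺ (h ∸ length β) ≤-refl
  dropColumn-map-suc : ∀ {γ} → All (0 <_) γ → dropColumn (map suc γ) ≡ γ
  dropColumn-map-suc {[]}        []        = refl
  dropColumn-map-suc {suc c ∷ γ} (_ ∷ γ>0) = cong (suc c ∷_) (dropColumn-map-suc γ>0)

addColumn-dropColumn : ∀ {β} → Nonincreasing β → All (0 <_) β →
  addColumn (length β) (dropColumn β) ≡ β
addColumn-dropColumn {[]}              _         _         = refl
addColumn-dropColumn {suc zero ∷ β}    (β≤1 ∷ _) (_ ∷ β>0) rewrite dropColumn-≤1 β≤1 =
  cong (1 ∷_) (sym (all-≡⇒replicate (All.zipWith {R = _≡ 1} (uncurry ≤-antisym) (β≤1 , β>0))))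
addColumn-dropColumn {suc (suc a) ∷ β} (_ ∷ β↓)  (_ ∷ β>0) =
  cong (suc (suc a) ∷_) (addColumn-dropColumn β↓ β>0)

-- Merging the columns of β into x

-- In merge b x β, b counts the columns of β still to be placed; the next one has height length β.
merge : ℕ → List ℕ → List ℕ → List ℕ × List ℕ
merge zero    x β = x , replicate (length x) 0
merge (suc b)     = go
  where
  go : List ℕ → List ℕ → List ℕ × List ℕ
  go []      β = map₁ (length β ∷_) (merge b [] (dropColumn β))
  go (a ∷ x) β with suc b + length β ≤? a
  ... | yes _ = Product.map (a ∸ suc b ∷_) (suc b ∷_) (go x β)
  ... | no  _ = map₁ (length β ∷_) (merge b (a ∷ x) (dropColumn β))

unmerge : ℕ → List ℕ → List ℕ → List ℕ × List ℕ
unmerge zero    z e = z , []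
unmerge (suc b)     = go
  where
  go : List ℕ → List ℕ → List ℕ × List ℕ
  go []       e        = [] , []
  go (z₁ ∷ z) []       = map₂ (addColumn z₁) (unmerge b z [])
  go (z₁ ∷ z) (e₁ ∷ e) with e₁ ≟ suc b
  ... | yes _ = map₁ (z₁ + suc b ∷_) (go z e)
  ... | no  _ = map₂ (addColumn z₁) (unmerge b z (e₁ ∷ e))

merge-part : ∀ b a x β → suc b + length β ≤ a →
  merge (suc b) (a ∷ x) β ≡ Product.map (a ∸ suc b ∷_) (suc b ∷_) (merge (suc b) x β)
merge-part b a x β fits with suc b + length β ≤? a
... | yes _     = refl
... | no  ¬fits = contradiction fits ¬fits

merge-column : ∀ b x β → All (_< suc b + length β) x →
  merge (suc b) x β ≡ map₁ (length β ∷_) (merge b x (dropColumn β))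
merge-column b []      β _            = refl
merge-column b (a ∷ x) β (a<b+1+β ∷ _) with suc b + length β ≤? a
... | yes fits = contradiction fits (<⇒≱ a<b+1+β)
... | no  _    = refl

unmerge-label : ∀ b z₁ z e →
  unmerge (suc b) (z₁ ∷ z) (suc b ∷ e) ≡ map₁ (z₁ + suc b ∷_) (unmerge (suc b) z e)
unmerge-label b z₁ z e rewrite ≟-diag (refl {x = suc b}) = refl

unmerge-column : ∀ b z₁ z e → All (_≤ b) e →
  unmerge (suc b) (z₁ ∷ z) e ≡ map₂ (addColumn z₁) (unmerge b z e)
unmerge-column b z₁ z []       _          = refl
unmerge-column b z₁ z (e₁ ∷ e) (e₁≤b ∷ _) with e₁ ≟ suc b
... | yes refl = contradiction e₁≤b 1+n≰n
... | no  _    = refl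

length-merge₁ : ∀ b x β → length (proj₁ (merge b x β)) ≡ length x + b
length-merge₁ zero    x β = sym (+-identityʳ (length x))
length-merge₁ (suc b)     = go
  where
  go : ∀ x β → length (proj₁ (merge (suc b) x β)) ≡ length x + suc b
  go []      β = cong suc (length-merge₁ b [] (dropColumn β))
  go (a ∷ x) β with suc b + length β ≤? a
  ... | yes _ = cong suc (go x β)
  ... | no  _ = trans (cong suc (length-merge₁ b (a ∷ x) (dropColumn β))) (sym (+-suc (suc (length x)) b))

length-merge₂ : ∀ b x β → length (proj₂ (merge b x β)) ≡ length x
length-merge₂ zero    x β = length-replicate (length x)
length-merge₂ (suc b)     = go
  where
  go : ∀ x β → length (proj₂ (merge (suc b) x β)) ≡ length x
  go []      β = length-merge₂ b [] (dropColumn β)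
  go (a ∷ x) β with suc b + length β ≤? a
  ... | yes _ = cong suc (go x β)
  ... | no  _ = length-merge₂ b (a ∷ x) (dropColumn β)

length-merge : ∀ b x β → let (z , e) = merge b x β in length z ≡ length e + b
length-merge b x β = trans (length-merge₁ b x β) (cong (_+ b) (sym (length-merge₂ b x β)))

merge₂-≤ : ∀ b x β → All (_≤ b) (proj₂ (merge b x β))
merge₂-≤ zero    x β = Allₚ.replicate⁺ (length x) z≤n
merge₂-≤ (suc b)     = go
  where
  go : ∀ x β → All (_≤ suc b) (proj₂ (merge (suc b) x β))
  go []      β = All.map m≤n⇒m≤1+n (merge₂-≤ b [] (dropColumn β))
  go (a ∷ x) β with suc b + length β ≤? a
  ... | yes _ = ≤-refl ∷ go x β
  ... | no  _ = All.map m≤n⇒m≤1+n (merge₂-≤ b (a ∷ x) (dropColumn β))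

merge₂-nonincreasing : ∀ b x β → Nonincreasing (proj₂ (merge b x β))
merge₂-nonincreasing zero    x β = replicate-nonincreasing (length x) 0
merge₂-nonincreasing (suc b)     = go
  where
  go : ∀ x β → Nonincreasing (proj₂ (merge (suc b) x β))
  go []      β = merge₂-nonincreasing b [] (dropColumn β)
  go (a ∷ x) β with suc b + length β ≤? a
  ... | yes _ = merge₂-≤ (suc b) x β ∷ go x β
  ... | no  _ = merge₂-nonincreasing b (a ∷ x) (dropColumn β)

column-first : ∀ {b a x L} → ¬ (suc b + L ≤ a) → All (_≤ a) x → All (λ c → c ∸ b ≤ L) (a ∷ x)
column-first {b} {a} ¬fits x≤a = All.map c∸b≤L (≤-refl ∷ x≤a)
  where
  c∸b≤L : ∀ {c} → c ≤ a → c ∸ b ≤ _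
  c∸b≤L {c} c≤a = m≤n+o⇒m∸n≤o c b (≤-trans c≤a (≤-pred (≰⇒> ¬fits)))

merge₁-≤ : ∀ b x β {h} → Nonincreasing x → All (λ a → a ∸ b ≤ h) x → length β ≤ h →
  All (_≤ h) (proj₁ (merge b x β))
merge₁-≤ zero    x β _ x≤h _ = x≤h
merge₁-≤ (suc b)     = go
  where
  go : ∀ x β {h} → Nonincreasing x → All (λ a → a ∸ suc b ≤ h) x → length β ≤ h →
    All (_≤ h) (proj₁ (merge (suc b) x β))
  go []      β _ _ β≤h =
    β≤h ∷ merge₁-≤ b [] (dropColumn β) [] [] (≤-trans (length-dropColumn β) β≤h)
  go (a ∷ x) β (a≥x ∷ x↓) (a≤h ∷ x≤h) β≤h with suc b + length β ≤? a
  ... | yes _     = a≤h ∷ go x β x↓ x≤h β≤h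
  ... | no  ¬fits = β≤h ∷ All.map (λ c≤β → ≤-trans c≤β β≤h)
    (merge₁-≤ b (a ∷ x) (dropColumn β) (a≥x ∷ x↓) (column-first ¬fits a≥x) (length-dropColumn β))

merge₁-nonincreasing : ∀ b x β → Nonincreasing x → Nonincreasing (proj₁ (merge b x β))
merge₁-nonincreasing zero    x β x↓ = x↓
merge₁-nonincreasing (suc b)     = go
  where
  go : ∀ x β → Nonincreasing x → Nonincreasing (proj₁ (merge (suc b) x β))
  go []      β _ =
    merge₁-≤ b [] (dropColumn β) [] [] (length-dropColumn β)
      ∷ merge₁-nonincreasing b [] (dropColumn β) []
  go (a ∷ x) β x↓@(a≥x ∷ x↓′) with suc b + length β ≤? a
  ... | yes fits  =
    merge₁-≤ (suc b) x β x↓′ (All.map (∸-monoˡ-≤ (suc b)) a≥x) β≤a∸b+1 ∷ go x β x↓′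
    where
    β≤a∸b+1 : length β ≤ a ∸ suc b
    β≤a∸b+1 = subst (_≤ a ∸ suc b) (m+n∸m≡n (suc b) (length β)) (∸-monoˡ-≤ (suc b) fits)
  ... | no  ¬fits =
    merge₁-≤ b (a ∷ x) (dropColumn β) x↓ (column-first ¬fits a≥x) (length-dropColumn β)
      ∷ merge₁-nonincreasing b (a ∷ x) (dropColumn β) x↓

merge-valid : ∀ b x β → Nonincreasing x →
  let (z , e) = merge b x β in Nonincreasing z × NonincreasingAtMost b e × length z ≡ length e + b
merge-valid b x β x↓ =
  merge₁-nonincreasing b x β x↓ ,
  (merge₂-nonincreasing b x β , merge₂-≤ b x β) ,
  length-merge b x β

sum-merge : ∀ b x β → PartsAtMost b β →
  let (z , e) = merge b x β in sum x + sum β ≡ sum z + sum e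
sum-merge zero    x β β≤0
  rewrite partsAtMost-0 β≤0 | sum-replicate (length x) 0 | *-zeroʳ (length x) = refl
sum-merge (suc b)     = go
  where
  open ≡-Reasoning
  column : ∀ s {β Z E} → All (0 <_) β →
    s + sum (dropColumn β) ≡ Z + E → s + sum β ≡ (length β + Z) + E
  column s {β} {Z} {E} β>0 eq = begin
    s + sum β                           ≡⟨ cong (s +_) (sum-dropColumn β>0) ⟩
    s + (length β + sum (dropColumn β)) ≡⟨ x∙yz≈y∙xz s (length β) _ ⟩
    length β + (s + sum (dropColumn β)) ≡⟨ cong (length β +_) eq ⟩
    length β + (Z + E)                  ≡⟨ +-assoc (length β) Z E ⟨
    length β + Z + E                    ∎
  go : ∀ x β → PartsAtMost (suc b) β → let (z , e) = merge (suc b) x β in sum x + sum β ≡ sum z + sum e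
  go []      β β≤b+1 =
    column 0 (proj₂ β≤b+1) (sum-merge b [] (dropColumn β) (dropColumn-partsAtMost β≤b+1))
  go (a ∷ x) β β≤b+1 with suc b + length β ≤? a
  ... | yes fits = begin
    a + sum x + sum β             ≡⟨ +-assoc a (sum x) (sum β) ⟩
    a + (sum x + sum β)           ≡⟨ cong₂ _+_ (sym (m∸n+n≡m (m+n≤o⇒m≤o (suc b) fits)))
                                                 (go x β β≤b+1) ⟩
    (a ∸ suc b + suc b) + (Z + E) ≡⟨ interchange (a ∸ suc b) (suc b) Z E ⟩
    (a ∸ suc b + Z) + (suc b + E) ∎
    where
    Z = sum (proj₁ (merge (suc b) x β))
    E = sum (proj₂ (merge (suc b) x β))
  ... | no  _ =
    column (a + sum x) (proj₂ β≤b+1) (sum-merge b (a ∷ x) (dropColumn β) (dropColumn-partsAtMost β≤b+1))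

unmerge₂-partsAtMost : ∀ b z e → PartsAtMost b (proj₂ (unmerge b z e))
unmerge₂-partsAtMost zero    z e = ([] , []) , []
unmerge₂-partsAtMost (suc b)     = go
  where
  go : ∀ z e → PartsAtMost (suc b) (proj₂ (unmerge (suc b) z e))
  go []       e        = ([] , []) , []
  go (z₁ ∷ z) []       = addColumn-partsAtMost z₁ (unmerge₂-partsAtMost b z [])
  go (z₁ ∷ z) (e₁ ∷ e) with e₁ ≟ suc b
  ... | yes _ = go z e
  ... | no  _ = addColumn-partsAtMost z₁ (unmerge₂-partsAtMost b z (e₁ ∷ e))

unmerge₁-≤ : ∀ b z e {h} → All (_≤ h) z → All (_≤ h + b) (proj₁ (unmerge b z e))
unmerge₁-≤ zero    z e {h} z≤h = All.map (λ c≤h → ≤-trans c≤h (m≤m+n h 0)) z≤h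
unmerge₁-≤ (suc b)     = go
  where
  weaken : ∀ {h l} → All (_≤ h + b) l → All (_≤ h + suc b) l
  weaken {h} = All.map (λ c≤h+b → ≤-trans c≤h+b (+-monoʳ-≤ h (n≤1+n b)))
  go : ∀ z e {h} → All (_≤ h) z → All (_≤ h + suc b) (proj₁ (unmerge (suc b) z e))
  go []       e        _            = []
  go (z₁ ∷ z) []       (_ ∷ z≤h)    = weaken (unmerge₁-≤ b z [] z≤h)
  go (z₁ ∷ z) (e₁ ∷ e) (z₁≤h ∷ z≤h) with e₁ ≟ suc b
  ... | yes _ = +-monoˡ-≤ (suc b) z₁≤h ∷ go z e z≤h
  ... | no  _ = weaken (unmerge₁-≤ b z (e₁ ∷ e) z≤h)

length-unmerge₂ : ∀ b z e {h} → Nonincreasing z → All (_≤ h) z → length (proj₂ (unmerge b z e)) ≤ h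
length-unmerge₂ zero    z e _ _ = z≤n
length-unmerge₂ (suc b)     = go
  where
  column : ∀ {z₁ z h} e → Nonincreasing (z₁ ∷ z) → z₁ ≤ h →
    length (addColumn z₁ (proj₂ (unmerge b z e))) ≤ h
  column {z₁} {z} e (z₁≥z ∷ z↓) z₁≤h = ≤-trans (≤-reflexive ∣col∣≡z₁) z₁≤h
    where ∣col∣≡z₁ = length-addColumn (proj₂ (unmerge b z e)) (length-unmerge₂ b z e z↓ z₁≥z)
  go : ∀ z e {h} → Nonincreasing z → All (_≤ h) z → length (proj₂ (unmerge (suc b) z e)) ≤ h
  go []       e        _                 _            = z≤n
  go (z₁ ∷ z) []       z↓                (z₁≤h ∷ _)   = column [] z↓ z₁≤h
  go (z₁ ∷ z) (e₁ ∷ e) z↓@(_ ∷ z↓′) (z₁≤h ∷ z≤h) with e₁ ≟ suc b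
  ... | yes _ = go z e z↓′ z≤h
  ... | no  _ = column (e₁ ∷ e) z↓ z₁≤h

unmerge₁-nonincreasing : ∀ b z e → Nonincreasing z → Nonincreasing (proj₁ (unmerge b z e))
unmerge₁-nonincreasing zero    z e z↓ = z↓
unmerge₁-nonincreasing (suc b)     = go
  where
  go : ∀ z e → Nonincreasing z → Nonincreasing (proj₁ (unmerge (suc b) z e))
  go []       e        _           = []
  go (z₁ ∷ z) []       (_ ∷ z↓)    = unmerge₁-nonincreasing b z [] z↓
  go (z₁ ∷ z) (e₁ ∷ e) (z₁≥z ∷ z↓) with e₁ ≟ suc b
  ... | yes _ = unmerge₁-≤ (suc b) z e z₁≥z ∷ go z e z↓
  ... | no  _ = unmerge₁-nonincreasing b z (e₁ ∷ e) z↓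

unmerge-valid : ∀ b z e → Nonincreasing z →
  let (x , β) = unmerge b z e in Nonincreasing x × PartsAtMost b β
unmerge-valid b z e z↓ = unmerge₁-nonincreasing b z e z↓ , unmerge₂-partsAtMost b z e

unmerge-merge : ∀ b x β → PartsAtMost b β → uncurry (unmerge b) (merge b x β) ≡ (x , β)
unmerge-merge zero    x β β≤0 rewrite partsAtMost-0 β≤0 = refl
unmerge-merge (suc b)     = go
  where
  open ≡-Reasoning
  column : ∀ x β → PartsAtMost (suc b) β →
    uncurry (unmerge (suc b)) (map₁ (length β ∷_) (merge b x (dropColumn β))) ≡ (x , β)
  column x β β≤b+1@((β↓ , _) , β>0) = begin
    unmerge (suc b) (length β ∷ z) e
      ≡⟨ unmerge-column b (length β) z e (merge₂-≤ b x (dropColumn β)) ⟩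
    map₂ (addColumn (length β)) (unmerge b z e)
      ≡⟨ cong (map₂ (addColumn (length β))) IH ⟩
    (x , addColumn (length β) (dropColumn β))
      ≡⟨ cong (x ,_) (addColumn-dropColumn β↓ β>0) ⟩
    (x , β)
      ∎
    where
    z = proj₁ (merge b x (dropColumn β))
    e = proj₂ (merge b x (dropColumn β))
    IH = unmerge-merge b x (dropColumn β) (dropColumn-partsAtMost β≤b+1)
  go : ∀ x β → PartsAtMost (suc b) β → uncurry (unmerge (suc b)) (merge (suc b) x β) ≡ (x , β)
  go []      β β≤b+1 = column [] β β≤b+1
  go (a ∷ x) β β≤b+1 with suc b + length β ≤? a
  ... | yes fits = begin
    unmerge (suc b) (a ∸ suc b ∷ z) (suc b ∷ e)
      ≡⟨ unmerge-label b (a ∸ suc b) z e ⟩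
    map₁ (a ∸ suc b + suc b ∷_) (unmerge (suc b) z e)
      ≡⟨ cong (map₁ (a ∸ suc b + suc b ∷_)) (go x β β≤b+1) ⟩
    (a ∸ suc b + suc b ∷ x , β)
      ≡⟨ cong (λ c → c ∷ x , β) (m∸n+n≡m (m+n≤o⇒m≤o (suc b) fits)) ⟩
    (a ∷ x , β)
      ∎
    where
    z = proj₁ (merge (suc b) x β)
    e = proj₂ (merge (suc b) x β)
  ... | no  _ = column (a ∷ x) β β≤b+1

merge-unmerge : ∀ b z e → NonincreasingAtMost b e → Nonincreasing z → length z ≡ length e + b →
  uncurry (merge b) (unmerge b z e) ≡ (z , e)
merge-unmerge zero    z e (_ , e≤0) _ ∣z∣≡∣e∣+0 = cong (z ,_) (begin
  replicate (length z) 0 ≡⟨ cong (λ k → replicate k 0) (trans ∣z∣≡∣e∣+0 (+-identityʳ _)) ⟩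
  replicate (length e) 0 ≡⟨ all-≡⇒replicate (All.map n≤0⇒n≡0 e≤0) ⟨
  e                      ∎)
  where open ≡-Reasoning
merge-unmerge (suc b)     = go
  where
  open ≡-Reasoning
  column : ∀ z₁ z e → NonincreasingAtMost b e → Nonincreasing (z₁ ∷ z) → length z ≡ length e + b →
    uncurry (merge (suc b)) (map₂ (addColumn z₁) (unmerge b z e)) ≡ (z₁ ∷ z , e)
  column z₁ z e e≤b (z₁≥z ∷ z↓) ∣z∣≡∣e∣+b = begin
    merge (suc b) x (addColumn z₁ β)
      ≡⟨ merge-column b x (addColumn z₁ β) x<b+1+∣col∣ ⟩
    map₁ (length (addColumn z₁ β) ∷_) (merge b x (dropColumn (addColumn z₁ β)))
      ≡⟨ cong₂ (λ h γ → map₁ (h ∷_) (merge b x γ)) ∣col∣≡z₁ (dropColumn-addColumn z₁ β>0) ⟩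
    map₁ (z₁ ∷_) (merge b x β)
      ≡⟨ cong (map₁ (z₁ ∷_)) (merge-unmerge b z e e≤b z↓ ∣z∣≡∣e∣+b) ⟩
    (z₁ ∷ z , e)
      ∎
    where
    x = proj₁ (unmerge b z e)
    β = proj₂ (unmerge b z e)
    β>0 = proj₂ (unmerge₂-partsAtMost b z e)
    ∣col∣≡z₁ : length (addColumn z₁ β) ≡ z₁
    ∣col∣≡z₁ = length-addColumn β (length-unmerge₂ b z e z↓ z₁≥z)
    x<b+1+∣col∣ : All (_< suc b + length (addColumn z₁ β)) x
    x<b+1+∣col∣ rewrite ∣col∣≡z₁ =
      All.map (λ c≤z₁+b → s≤s (≤-trans c≤z₁+b (≤-reflexive (+-comm z₁ b))))
              (unmerge₁-≤ b z e z₁≥z)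
  go : ∀ z e → NonincreasingAtMost (suc b) e → Nonincreasing z → length z ≡ length e + suc b →
    uncurry (merge (suc b)) (unmerge (suc b) z e) ≡ (z , e)
  go []       e        _     _  0≡∣e∣+b+1 = contradiction (trans 0≡∣e∣+b+1 (+-suc (length e) b)) 0≢1+n
  go (z₁ ∷ z) []       _     z↓ ∣z∣+1≡b+1 = column z₁ z [] ([] , []) z↓ (suc-injective ∣z∣+1≡b+1)
  go (z₁ ∷ z) (e₁ ∷ e) e≤b+1 z↓ ∣z∣+1≡∣e∣+b+2 with e₁ ≟ suc b
  ... | yes refl = begin
    merge (suc b) (z₁ + suc b ∷ x) β
      ≡⟨ merge-part b (z₁ + suc b) x β fits ⟩
    Product.map (z₁ + suc b ∸ suc b ∷_) (suc b ∷_) (merge (suc b) x β)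
      ≡⟨ cong (Product.map (z₁ + suc b ∸ suc b ∷_) (suc b ∷_)) IH ⟩
    (z₁ + suc b ∸ suc b ∷ z , suc b ∷ e)
      ≡⟨ cong (λ c → c ∷ z , suc b ∷ e) (m+n∸n≡m z₁ (suc b)) ⟩
    (z₁ ∷ z , suc b ∷ e)
      ∎
    where
    x = proj₁ (unmerge (suc b) z e)
    β = proj₂ (unmerge (suc b) z e)
    z↓′ = AllPairs.tail z↓
    IH = go z e (Product.map AllPairs.tail All.tail e≤b+1) z↓′ (suc-injective ∣z∣+1≡∣e∣+b+2)
    fits : suc b + length β ≤ z₁ + suc b
    fits = ≤-trans (+-monoʳ-≤ (suc b) (length-unmerge₂ (suc b) z e z↓′ (AllPairs.head z↓)))
                   (≤-reflexive (+-comm (suc b) z₁))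
  ... | no e₁≢b+1 = column z₁ z (e₁ ∷ e) (nonincreasingAtMost-pred e₁≢b+1 e≤b+1) z↓
                           (trans (suc-injective ∣z∣+1≡∣e∣+b+2) (+-suc (length e) b))

-- Cutting λ at the block iⁱ

splitBlock : ℕ → List ℕ → List ℕ × List ℕ
splitBlock i l = map (_∸ suc i) (filter (i <?_) l) , filter (_<? i) l

joinBlock : ℕ → List ℕ → List ℕ → List ℕ
joinBlock i x β = map (_+ suc i) x ++ replicate i i ++ β

filter-trichotomy : ∀ i {l} → Nonincreasing l →
  filter (i <?_) l ++ filter (_≟ i) l ++ filter (_<? i) l ≡ l
filter-trichotomy i {[]}    []         = refl
filter-trichotomy i {y ∷ l} (y≥l ∷ l↓) with <-cmp i y
... | tri< i<y _ _
  rewrite filter-accept (i <?_) {xs = l} i<y | filter-reject (_≟ i) {xs = l} (>⇒≢ i<y)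
        | filter-reject (_<? i) {xs = l} (<⇒≯ i<y)
        = cong (y ∷_) (filter-trichotomy i l↓)
... | tri> _ _ y<i
  rewrite filter-reject (i <?_) {xs = l} (<⇒≯ y<i) | filter-reject (_≟ i) {xs = l} (<⇒≢ y<i)
        | filter-accept (_<? i) {xs = l} y<i
        | filter-none (i <?_) (All.map (λ c≤y → <⇒≯ (≤-<-trans c≤y y<i)) y≥l)
        | filter-none (_≟ i) (All.map (λ c≤y → <⇒≢ (≤-<-trans c≤y y<i)) y≥l)
        | filter-all (_<? i) (All.map (λ c≤y → ≤-<-trans c≤y y<i) y≥l)
        = refl
... | tri≈ _ refl _ with filter-trichotomy i l↓
... | IH
  rewrite filter-reject (i <?_) {xs = l} (<-irrefl refl) | filter-accept (_≟ i) {xs = l} refl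
        | filter-reject (_<? i) {xs = l} (<-irrefl refl)
        | filter-none (i <?_) (All.map ≤⇒≯ y≥l)
        = cong (i ∷_) IH

joinBlock-splitBlock : ∀ i {l} → Nonincreasing l → multiplicity i l ≡ i →
  uncurry (joinBlock i) (splitBlock i l) ≡ l
joinBlock-splitBlock i {l} l↓ mult = begin
  map (_+ suc i) (map (_∸ suc i) above) ++ replicate i i ++ below
    ≡⟨ cong₂ (λ a r → a ++ r ++ below) above≡ block≡ ⟩
  above ++ filter (_≟ i) l ++ below
    ≡⟨ filter-trichotomy i l↓ ⟩
  l ∎
  where
  open ≡-Reasoning
  above = filter (i <?_) l
  below = filter (_<? i) l
  above≡ = map-+-∸ (suc i) (Allₚ.all-filter (i <?_) l)
  block≡ : replicate i i ≡ filter (_≟ i) l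
  block≡ = trans (cong (λ k → replicate k i) (sym mult))
                 (sym (all-≡⇒replicate (Allₚ.all-filter (_≟ i) l)))

splitBlock-joinBlock : ∀ i x {β} → All (_< i) β → splitBlock i (joinBlock i x β) ≡ (x , β)
splitBlock-joinBlock i x {β} β<i = cong₂ _,_ above≡ below≡
  where
  shifted = map (_+ suc i) x
  above≡ : map (_∸ suc i) (filter (i <?_) (shifted ++ replicate i i ++ β)) ≡ x
  above≡ rewrite filter-++ (i <?_) shifted (replicate i i ++ β) | filter-++ (i <?_) (replicate i i) β
    | filter-all (i <?_) (map-+-≥ (suc i) x) | filter-none (i <?_) (Allₚ.replicate⁺ i (<-irrefl refl))
    | filter-none (i <?_) (All.map <⇒≯ β<i) | ++-identityʳ shifted
    = map-∸-+ (suc i) x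
  below≡ : filter (_<? i) (shifted ++ replicate i i ++ β) ≡ β
  below≡ rewrite filter-++ (_<? i) shifted (replicate i i ++ β) | filter-++ (_<? i) (replicate i i) β
    | filter-none (_<? i) (All.map <⇒≯ (map-+-≥ (suc i) x))
    | filter-none (_<? i) (Allₚ.replicate⁺ i (<-irrefl refl))
    | filter-all (_<? i) β<i
    = refl

splitBlock-valid : ∀ b {l} → Nonincreasing l → All (0 <_) l →
  let (x , β) = splitBlock (suc b) l in Nonincreasing x × PartsAtMost b β
splitBlock-valid b {l} l↓ l>0 =
  map-nonincreasing (∸-monoˡ-≤ (suc (suc b))) (AllPairsₚ.filter⁺ (suc b <?_) l↓) ,
  (AllPairsₚ.filter⁺ (_<? suc b) l↓ , All.map ≤-pred (Allₚ.all-filter (_<? suc b) l)) ,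
  Allₚ.filter⁺ (_<? suc b) l>0

joinBlock-valid : ∀ b {x β} → Nonincreasing x → PartsAtMost b β →
  let l = joinBlock (suc b) x β in Nonincreasing l × All (0 <_) l × multiplicity (suc b) l ≡ suc b
joinBlock-valid b {x} {β} x↓ ((β↓ , β≤b) , β>0) = sorted , positive , mult
  where
  i = suc b
  shifted>i = map-+-≥ (suc i) x
  β≤i = All.map m≤n⇒m≤1+n β≤b
  sorted : Nonincreasing (map (_+ suc i) x ++ replicate i i ++ β)
  sorted = ++-nonincreasing (suc i) (map-nonincreasing (+-monoˡ-≤ (suc i)) x↓)
    (++-nonincreasing i (replicate-nonincreasing i i) β↓ (Allₚ.replicate⁺ i ≤-refl) β≤i)
    shifted>i (Allₚ.++⁺ (Allₚ.replicate⁺ i (n≤1+n i)) (All.map m≤n⇒m≤1+n β≤i))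
  positive : All (0 <_) (map (_+ suc i) x ++ replicate i i ++ β)
  positive = Allₚ.++⁺ (All.map (≤-<-trans z≤n) shifted>i)
                      (Allₚ.++⁺ (Allₚ.replicate⁺ i (s≤s z≤n)) β>0)
  mult : length (filter (_≟ i) (map (_+ suc i) x ++ replicate i i ++ β)) ≡ i
  mult rewrite filter-++ (_≟ i) (map (_+ suc i) x) (replicate i i ++ β) | filter-++ (_≟ i) (replicate i i) β
    | filter-none (_≟ i) (All.map >⇒≢ shifted>i) | filter-all (_≟ i) (Allₚ.replicate⁺ i refl)
    | filter-none (_≟ i) (All.map (λ c≤b → <⇒≢ (s≤s c≤b)) β≤b)
    = trans (cong length (++-identityʳ (replicate i i))) (length-replicate i)

sum-joinBlock : ∀ i x β → sum (joinBlock i x β) ≡ (sum x + sum β) + (length x * suc i + i * i)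
sum-joinBlock i x β = begin
  sum (shifted ++ replicate i i ++ β)           ≡⟨ sum-++ shifted _ ⟩
  sum shifted + sum (replicate i i ++ β)        ≡⟨ cong (sum shifted +_) (sum-++ (replicate i i) β) ⟩
  sum shifted + (sum (replicate i i) + sum β)   ≡⟨ cong₂ (λ c d → c + (d + sum β)) (sum-map-+ (suc i) x)
                                                                                   (sum-replicate i i) ⟩
  sum x + length x * suc i + (i * i + sum β)    ≡⟨ regroup (sum x) (sum β) (length x * suc i) (i * i) ⟩
  (sum x + sum β) + (length x * suc i + i * i)  ∎
  where
  open ≡-Reasoning
  shifted = map (_+ suc i) x
  regroup : ∀ X B M I → X + M + (I + B) ≡ (X + B) + (M + I)
  regroup = solve-∀

-- Cutting μ at a hook index

splitHook : ℕ → (μ : List ℕ) → Fin (length μ) → List ℕ × List ℕ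
splitHook i μ k = map (_∸ i) (take (toℕ k) μ) , map pred (drop (suc (toℕ k)) μ)

joinHook : ℕ → List ℕ → List ℕ → List ℕ
joinHook i z e = map (_+ i) z ++ i ∷ map suc e

take-lookup-drop : ∀ (μ : List ℕ) k → take (toℕ k) μ ++ lookup μ k ∷ drop (suc (toℕ k)) μ ≡ μ
take-lookup-drop (m ∷ μ) zero    = refl
take-lookup-drop (m ∷ μ) (suc k) = cong (m ∷_) (take-lookup-drop μ k)

nonincreasing-around : ∀ {μ} k → Nonincreasing μ →
  All (lookup μ k ≤_) (take (toℕ k) μ) × All (_≤ lookup μ k) (drop (suc (toℕ k)) μ)
nonincreasing-around {m ∷ μ} zero    (m≥μ ∷ _)  = [] , m≥μ
nonincreasing-around {m ∷ μ} (suc k) (m≥μ ∷ μ↓) =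
  Product.map₁ (All.lookup m≥μ (∈-lookup k) ∷_) (nonincreasing-around k μ↓)

hook1≡lookup+below : ∀ μ k → hook1 μ k ≡ lookup μ k + (length μ ∸ suc (toℕ k))
hook1≡lookup+below μ k = +-∸-assoc (lookup μ k) (toℕ<n k)

hookIndex : ∀ {b} μ k → lookup μ k ≡ suc b → hook1 μ k ≡ suc (toℕ k) →
  toℕ k ≡ b + (length μ ∸ suc (toℕ k))
hookIndex μ k μₖ≡b+1 hook≡k+1 = suc-injective (begin
  suc (toℕ k)                           ≡⟨ hook≡k+1 ⟨
  hook1 μ k                             ≡⟨ hook1≡lookup+below μ k ⟩
  lookup μ k + (length μ ∸ suc (toℕ k)) ≡⟨ cong (_+ (length μ ∸ suc (toℕ k))) μₖ≡b+1 ⟩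
  suc _                                 ∎)
  where open ≡-Reasoning

hookIndex-≮ : ∀ {b t K K′} → K′ < t →
  K ≡ b + (t ∸ suc K) → K′ ≡ b + (t ∸ suc K′) → ¬ K < K′
hookIndex-≮ {b} K′<t K≡ K′≡ K<K′ =
  <-asym K<K′ (subst₂ _<_ (sym K′≡) (sym K≡) (+-monoʳ-< b (∸-monoʳ-< (s≤s K<K′) K′<t)))

hookIndex-unique : ∀ {b t K K′} → K < t → K′ < t →
  K ≡ b + (t ∸ suc K) → K′ ≡ b + (t ∸ suc K′) → K ≡ K′
hookIndex-unique K<t K′<t K≡ K′≡ =
  ≤-antisym (≮⇒≥ (hookIndex-≮ K<t K′≡ K≡)) (≮⇒≥ (hookIndex-≮ K′<t K≡ K′≡))

length-joinHook : ∀ i z e → length (joinHook i z e) ≡ length z + suc (length e)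
length-joinHook i z e =
  trans (length-++ (map (_+ i) z)) (cong₂ _+_ (length-map (_+ i) z) (cong suc (length-map suc e)))

joinHook-hookIndex : ∀ b z e → length z ≡ length e + b → let μ = joinHook (suc b) z e in
  Σ (Fin (length μ)) λ k → toℕ k ≡ length z × lookup μ k ≡ suc b × hook1 μ k ≡ suc (toℕ k)
joinHook-hookIndex b z e ∣z∣≡∣e∣+b = k , k≡∣z∣ , μₖ≡b+1 , hook≡k+1
  where
  open ≡-Reasoning
  μ = joinHook (suc b) z e
  position : ∀ z → let μ = joinHook (suc b) z e in
    Σ (Fin (length μ)) λ k → toℕ k ≡ length z × lookup μ k ≡ suc b
  position []      = zero , refl , refl
  position (_ ∷ z) = Product.map suc (Product.map₁ (cong suc)) (position z)
  k = proj₁ (position z)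
  k≡∣z∣ = proj₁ (proj₂ (position z))
  μₖ≡b+1 = proj₂ (proj₂ (position z))
  ∣μ∣≡∣z∣+∣e∣+1 = trans (length-joinHook (suc b) z e) (+-suc (length z) (length e))
  hook≡k+1 : hook1 μ k ≡ suc (toℕ k)
  hook≡k+1 = begin
    hook1 μ k
      ≡⟨ hook1≡lookup+below μ k ⟩
    lookup μ k + (length μ ∸ suc (toℕ k))
      ≡⟨ cong₂ (λ c K → c + (length μ ∸ suc K)) μₖ≡b+1 k≡∣z∣ ⟩
    suc b + (length μ ∸ suc (length z))
      ≡⟨ cong (λ t → suc b + (t ∸ suc (length z))) ∣μ∣≡∣z∣+∣e∣+1 ⟩
    suc b + (length z + length e ∸ length z)
      ≡⟨ cong (suc b +_) (m+n∸m≡n (length z) (length e)) ⟩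
    suc (b + length e)
      ≡⟨ cong suc (trans (+-comm b (length e)) (sym ∣z∣≡∣e∣+b)) ⟩
    suc (length z)
      ≡⟨ cong suc k≡∣z∣ ⟨
    suc (toℕ k)
      ∎

joinHook-splitHook : ∀ i {μ} k → Nonincreasing μ → All (0 <_) μ → lookup μ k ≡ i →
  uncurry (joinHook i) (splitHook i μ k) ≡ μ
joinHook-splitHook i {μ} k μ↓ μ>0 μₖ≡i = begin
  map (_+ i) (map (_∸ i) above) ++ i ∷ map suc (map pred below)
    ≡⟨ cong₂ (λ a c → a ++ i ∷ c) above≡ below≡ ⟩
  above ++ i ∷ below
    ≡⟨ cong (λ c → above ++ c ∷ below) μₖ≡i ⟨
  above ++ lookup μ k ∷ below
    ≡⟨ take-lookup-drop μ k ⟩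
  μ ∎
  where
  open ≡-Reasoning
  above = take (toℕ k) μ
  below = drop (suc (toℕ k)) μ
  above≡ = map-+-∸ i (subst (λ c → All (c ≤_) above) μₖ≡i (proj₁ (nonincreasing-around k μ↓)))
  below≡ : map suc (map pred below) ≡ below
  below≡ = trans (sym (map-∘ below))
                 (map-id-local (All.map (λ { {suc _} _ → refl }) (Allₚ.drop⁺ (suc (toℕ k)) μ>0)))

splitHook-joinHook : ∀ b {z e} k → length z ≡ length e + b → let μ = joinHook (suc b) z e in
  lookup μ k ≡ suc b → hook1 μ k ≡ suc (toℕ k) → splitHook (suc b) μ k ≡ (z , e)
splitHook-joinHook b {z} {e} k ∣z∣≡∣e∣+b μₖ≡b+1 hook≡k+1 with joinHook-hookIndex b z e ∣z∣≡∣e∣+b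
... | k₀ , k₀≡∣z∣ , μₖ₀≡b+1 , hook≡k₀+1 = cong₂ _,_ above≡ below≡
  where
  μ = joinHook (suc b) z e
  shifted = map (_+ suc b) z
  k≡∣shifted∣ : toℕ k ≡ length shifted
  k≡∣shifted∣ = begin
    toℕ k          ≡⟨ hookIndex-unique (toℕ<n k) (toℕ<n k₀) (hookIndex μ k μₖ≡b+1 hook≡k+1)
                                                            (hookIndex μ k₀ μₖ₀≡b+1 hook≡k₀+1) ⟩
    toℕ k₀         ≡⟨ k₀≡∣z∣ ⟩
    length z       ≡⟨ length-map (_+ suc b) z ⟨
    length shifted ∎
    where open ≡-Reasoning
  above≡ : map (_∸ suc b) (take (toℕ k) μ) ≡ z
  above≡ rewrite k≡∣shifted∣ | take-length-++ shifted (suc b ∷ map suc e) = map-∸-+ (suc b) z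
  below≡ : map pred (drop (suc (toℕ k)) μ) ≡ e
  below≡ rewrite k≡∣shifted∣ | drop-length-++-∷ shifted (suc b) (map suc e) =
    trans (sym (map-∘ e)) (map-id e)

splitHook-valid : ∀ b {μ} k → Nonincreasing μ → lookup μ k ≡ suc b → hook1 μ k ≡ suc (toℕ k) →
  let (z , e) = splitHook (suc b) μ k in
  Nonincreasing z × NonincreasingAtMost b e × length z ≡ length e + b
splitHook-valid b {μ} k μ↓ μₖ≡b+1 hook≡k+1 =
  map-nonincreasing (∸-monoˡ-≤ (suc b)) (AllPairsₚ.take⁺ (toℕ k) μ↓) ,
  (map-nonincreasing pred-mono-≤ (AllPairsₚ.drop⁺ (suc (toℕ k)) μ↓) ,
   Allₚ.map⁺ (All.map pred-mono-≤ below≤b+1)) ,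
  (begin
    length (map (_∸ suc b) above) ≡⟨ length-map (_∸ suc b) above ⟩
    length above                  ≡⟨ length-take (toℕ k) μ ⟩
    toℕ k ⊓ length μ              ≡⟨ m≤n⇒m⊓n≡m (<⇒≤ (toℕ<n k)) ⟩
    toℕ k                         ≡⟨ hookIndex μ k μₖ≡b+1 hook≡k+1 ⟩
    b + (length μ ∸ suc (toℕ k))  ≡⟨ +-comm b _ ⟩
    (length μ ∸ suc (toℕ k)) + b  ≡⟨ cong (_+ b) (trans (length-map pred below) (length-drop (suc (toℕ k)) μ)) ⟨
    length (map pred below) + b   ∎)
  where
  open ≡-Reasoning
  above = take (toℕ k) μ
  below = drop (suc (toℕ k)) μ
  below≤b+1 = subst (λ c → All (_≤ c) below) μₖ≡b+1 (proj₂ (nonincreasing-around k μ↓))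

joinHook-valid : ∀ b {z e} → Nonincreasing z → NonincreasingAtMost b e → length z ≡ length e + b →
  let μ = joinHook (suc b) z e in Nonincreasing μ × All (0 <_) μ × True (HasHookIndex? (suc b) μ)
joinHook-valid b {z} {e} z↓ (e↓ , e≤b) ∣z∣≡∣e∣+b with joinHook-hookIndex b z e ∣z∣≡∣e∣+b
... | k , _ , μₖ≡b+1 , hook≡k+1 = sorted , positive , fromWitness (k , hook≡k+1 , μₖ≡b+1)
  where
  i = suc b
  shifted≥i = map-+-≥ i z
  e+1≤i = Allₚ.map⁺ (All.map s≤s e≤b)
  sorted : Nonincreasing (joinHook i z e)
  sorted = ++-nonincreasing i (map-nonincreasing (+-monoˡ-≤ i) z↓)
    (e+1≤i ∷ map-nonincreasing s≤s e↓) shifted≥i (≤-refl ∷ e+1≤i)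
  positive : All (0 <_) (joinHook i z e)
  positive = Allₚ.++⁺ (All.map (≤-trans (s≤s z≤n)) shifted≥i)
                      (s≤s z≤n ∷ Allₚ.map⁺ (All.universal (λ _ → s≤s z≤n) e))

sum-joinHook : ∀ b z e → length z ≡ length e + b →
  sum (joinHook (suc b) z e) ≡ (sum z + sum e) + (length e * suc (suc b) + suc b * suc b)
sum-joinHook b z e ∣z∣≡∣e∣+b = begin
  sum (map (_+ suc b) z ++ suc b ∷ map suc e)
    ≡⟨ sum-++ (map (_+ suc b) z) _ ⟩
  sum (map (_+ suc b) z) + (suc b + sum (map suc e))
    ≡⟨ cong₂ (λ c d → c + (suc b + d)) (sum-map-+ (suc b) z) (sum-map-suc e) ⟩
  sum z + length z * suc b + (suc b + (sum e + length e))
    ≡⟨ cong (λ l → sum z + l * suc b + (suc b + (sum e + length e))) ∣z∣≡∣e∣+b ⟩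
  sum z + (length e + b) * suc b + (suc b + (sum e + length e))
    ≡⟨ regroup (sum z) (sum e) (length e) b ⟩
  (sum z + sum e) + (length e * suc (suc b) + suc b * suc b)
    ∎
  where
  open ≡-Reasoning
  regroup : ∀ Z E m b →
    Z + (m + b) * suc b + (suc b + (E + m)) ≡ (Z + E) + (m * suc (suc b) + suc b * suc b)
  regroup = solve-∀

sum-joinHook-merge : ∀ b x β → PartsAtMost b β →
  sum (uncurry (joinHook (suc b)) (merge b x β)) ≡ sum (joinBlock (suc b) x β)
sum-joinHook-merge b x β β≤b = begin
  sum (joinHook (suc b) z e)
    ≡⟨ sum-joinHook b z e (length-merge b x β) ⟩
  (sum z + sum e) + (length e * suc (suc b) + suc b * suc b)
    ≡⟨ cong₂ (λ s m → s + (m * suc (suc b) + suc b * suc b))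
             (sum-merge b x β β≤b) (sym (length-merge₂ b x β)) ⟨
  (sum x + sum β) + (length x * suc (suc b) + suc b * suc b)
    ≡⟨ sum-joinBlock (suc b) x β ⟨
  sum (joinBlock (suc b) x β)
    ∎
  where
  open ≡-Reasoning
  z = proj₁ (merge b x β)
  e = proj₂ (merge b x β)

blockToHook : ℕ → List ℕ → List ℕ
blockToHook b l = uncurry (joinHook (suc b)) (uncurry (merge b) (splitBlock (suc b) l))

hookToBlock : ℕ → (μ : List ℕ) → Fin (length μ) → List ℕ
hookToBlock b μ k = uncurry (joinBlock (suc b)) (uncurry (unmerge b) (splitHook (suc b) μ k))

blockToHook-valid : ∀ b {n l} → IsPartition n l → multiplicity (suc b) l ≡ suc b →
  IsPartition n (blockToHook b l) × True (HasHookIndex? (suc b) (blockToHook b l))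
blockToHook-valid b {n} {l} (l↗ , l>0 , Σl≡n) mult =
  let l↓                     = Linked⇒Nonincreasing l↗
      (x , β)                = splitBlock (suc b) l
      (x↓ , β≤b)             = splitBlock-valid b l↓ l>0
      (z↓ , e≤b , ∣z∣≡∣e∣+b) = merge-valid b x β x↓
      (μ↓ , μ>0 , hasHook)   = joinHook-valid b z↓ e≤b ∣z∣≡∣e∣+b
      Σμ≡n                   = trans (sum-joinHook-merge b x β β≤b)
                                     (trans (cong sum (joinBlock-splitBlock (suc b) l↓ mult)) Σl≡n)
  in (Nonincreasing⇒Linked μ↓ , μ>0 , Σμ≡n) , hasHook

hookToBlock-valid : ∀ b {n μ} k → IsPartition n μ → lookup μ k ≡ suc b → hook1 μ k ≡ suc (toℕ k) →
  IsPartition n (hookToBlock b μ k) × multiplicity (suc b) (hookToBlock b μ k) ≡ suc b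
hookToBlock-valid b {n} {μ} k (μ↗ , μ>0 , Σμ≡n) μₖ≡b+1 hook≡k+1 =
  let μ↓                     = Linked⇒Nonincreasing μ↗
      (z , e)                = splitHook (suc b) μ k
      (x , β)                = unmerge b z e
      (z↓ , e≤b , ∣z∣≡∣e∣+b) = splitHook-valid b k μ↓ μₖ≡b+1 hook≡k+1
      (x↓ , β≤b)             = unmerge-valid b z e z↓
      (λ↓ , λ>0 , mult)      = joinBlock-valid b x↓ β≤b
      Σλ≡n                   = begin
        sum (joinBlock (suc b) x β)
          ≡⟨ sum-joinHook-merge b x β β≤b ⟨
        sum (uncurry (joinHook (suc b)) (merge b x β))
          ≡⟨ cong (sum ∘ uncurry (joinHook (suc b))) (merge-unmerge b z e e≤b z↓ ∣z∣≡∣e∣+b) ⟩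
        sum (joinHook (suc b) z e)
          ≡⟨ cong sum (joinHook-splitHook (suc b) k μ↓ μ>0 μₖ≡b+1) ⟩
        sum μ
          ≡⟨ Σμ≡n ⟩
        n ∎
  in (Nonincreasing⇒Linked λ↓ , λ>0 , Σλ≡n) , mult
  where open ≡-Reasoning

hookToBlock-blockToHook : ∀ b {l} → Nonincreasing l → All (0 <_) l → multiplicity (suc b) l ≡ suc b →
  ∀ k → lookup (blockToHook b l) k ≡ suc b → hook1 (blockToHook b l) k ≡ suc (toℕ k) →
  hookToBlock b (blockToHook b l) k ≡ l
hookToBlock-blockToHook b {l} l↓ l>0 mult k μₖ≡b+1 hook≡k+1 = begin
  uncurry (joinBlock (suc b)) (uncurry (unmerge b) (splitHook (suc b) (joinHook (suc b) z e) k))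
    ≡⟨ cong (uncurry (joinBlock (suc b)) ∘ uncurry (unmerge b))
            (splitHook-joinHook b k ∣z∣≡∣e∣+b μₖ≡b+1 hook≡k+1) ⟩
  uncurry (joinBlock (suc b)) (uncurry (unmerge b) (merge b x β))
    ≡⟨ cong (uncurry (joinBlock (suc b))) (unmerge-merge b x β (proj₂ (splitBlock-valid b l↓ l>0))) ⟩
  joinBlock (suc b) x β
    ≡⟨ joinBlock-splitBlock (suc b) l↓ mult ⟩
  l ∎
  where
  open ≡-Reasoning
  x = proj₁ (splitBlock (suc b) l)
  β = proj₂ (splitBlock (suc b) l)
  z = proj₁ (merge b x β)
  e = proj₂ (merge b x β)
  ∣z∣≡∣e∣+b = length-merge b x β

blockToHook-hookToBlock : ∀ b {μ} k → Nonincreasing μ → All (0 <_) μ → lookup μ k ≡ suc b →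
  hook1 μ k ≡ suc (toℕ k) → blockToHook b (hookToBlock b μ k) ≡ μ
blockToHook-hookToBlock b {μ} k μ↓ μ>0 μₖ≡b+1 hook≡k+1 = begin
  uncurry (joinHook (suc b)) (uncurry (merge b) (splitBlock (suc b) (joinBlock (suc b) x β)))
    ≡⟨ cong (uncurry (joinHook (suc b)) ∘ uncurry (merge b)) (splitBlock-joinBlock (suc b) x β<b+1) ⟩
  uncurry (joinHook (suc b)) (merge b x β)
    ≡⟨ cong (uncurry (joinHook (suc b))) (merge-unmerge b z e e≤b z↓ ∣z∣≡∣e∣+b) ⟩
  joinHook (suc b) z e
    ≡⟨ joinHook-splitHook (suc b) k μ↓ μ>0 μₖ≡b+1 ⟩
  μ ∎
  where
  open ≡-Reasoning
  z = proj₁ (splitHook (suc b) μ k)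
  e = proj₂ (splitHook (suc b) μ k)
  x = proj₁ (unmerge b z e)
  β = proj₂ (unmerge b z e)
  z↓ = proj₁ (splitHook-valid b k μ↓ μₖ≡b+1 hook≡k+1)
  e≤b = proj₁ (proj₂ (splitHook-valid b k μ↓ μₖ≡b+1 hook≡k+1))
  ∣z∣≡∣e∣+b = proj₂ (proj₂ (splitHook-valid b k μ↓ μₖ≡b+1 hook≡k+1))
  β<b+1 = All.map s≤s (proj₂ (proj₁ (unmerge₂-partsAtMost b z e)))

IsPartition-irrelevant : ∀ {n l} → Irrelevant (IsPartition n l)
IsPartition-irrelevant (l↗ , l>0 , Σl≡n) (l↗′ , l>0′ , Σl≡n′) =
  cong₂ _,_ (Linked.irrelevant ≤-irrelevant l↗ l↗′)
            (cong₂ _,_ (All.irrelevant ≤-irrelevant l>0 l>0′) (≡-irrelevant Σl≡n Σl≡n′))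

≡-by-parts : ∀ {n} {P : List ℕ → Set} → (∀ {l} → Irrelevant (P l)) →
  {p q : Σ (Partition n) (P ∘ proj₁)} → proj₁ (proj₁ p) ≡ proj₁ (proj₁ q) → p ≡ q
≡-by-parts P-irr eq = ≡-by-proj₁ P-irr (≡-by-proj₁ IsPartition-irrelevant eq)

WithBlock : ℕ → ℕ → Set
WithBlock n i = Σ (Partition n) λ λ′ → True (multiplicity i (proj₁ λ′) ≟ i)

WithHook : ℕ → ℕ → Set
WithHook n i = Σ (Partition n) λ μ → True (HasHookIndex? i (proj₁ μ))

module _ {n b : ℕ} where

  toHook : WithBlock n (suc b) → WithHook n (suc b)
  toHook ((l , l∈Pₙ) , mult) =
    Product.map (blockToHook b l ,_) id (blockToHook-valid b l∈Pₙ (toWitness mult))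

  toBlock : WithHook n (suc b) → WithBlock n (suc b)
  toBlock ((μ , μ∈Pₙ) , hasHook) =
    let (k , hook≡k+1 , μₖ≡b+1) = toWitness hasHook in
    Product.map (hookToBlock b μ k ,_) fromWitness (hookToBlock-valid b k μ∈Pₙ μₖ≡b+1 hook≡k+1)

  toHook-toBlock : ∀ μ → toHook (toBlock μ) ≡ μ
  toHook-toBlock ((μ , (μ↗ , μ>0 , _)) , hasHook) =
    let (k , hook≡k+1 , μₖ≡b+1) = toWitness hasHook in
    ≡-by-parts T-irrelevant
      (blockToHook-hookToBlock b k (Linked⇒Nonincreasing μ↗) μ>0 μₖ≡b+1 hook≡k+1)

  toBlock-toHook : ∀ λ′ → toBlock (toHook λ′) ≡ λ′
  toBlock-toHook λ′@((l , (l↗ , l>0 , _)) , mult) =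
    let (k , hook≡k+1 , μₖ≡b+1) = toWitness (proj₂ (toHook λ′)) in
    ≡-by-parts T-irrelevant
      (hookToBlock-blockToHook b (Linked⇒Nonincreasing l↗) l>0 (toWitness mult) k μₖ≡b+1 hook≡k+1)

mainTheorem2 : (n i : ℕ) → 1 ≤ n → 1 ≤ i →
    (Σ (Partition n) λ λ′ → True (multiplicity i (proj₁ λ′) ≟ i))
      ↔ (Σ (Partition n) λ μ → True (HasHookIndex? i (proj₁ μ)))
mainTheorem2 n zero    _ ()
mainTheorem2 n (suc b) _ _ = mk↔ₛ′ toHook toBlock toHook-toBlock toBlock-toHook
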